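{- For all positive integers $n$ and $\sigma$, $\mathit{SQ}'_{\mathrm{param}}(n,\sigma)\le 2\sigma!\,n$ and $\mathit{SQ}_{\mathrm{param}}(n,\sigma)\le 2(\sigma!)^2 n$.
   Context: Two words $u,v$ are equivalent in the parameterized sense if $|u|=|v|$ and there is a bijection $f:\mathrm{Alph}(u)\to\mathrm{Alph}(v)$ ($\mathrm{Alph}$ = set of letters occurring) with $v[t]=f(u[t])$ for all $t$. A parameterized square is a word $uv$ with $u,v$ nonempty and equivalent in the parameterized sense. $\mathit{SQ}_{\mathrm{param}}(n,\sigma)$ is the maximum, over words $w$ of length $n$ over an alphabet of size $\sigma$, of the number of subwords (contiguous factors) of $w$ that are parameterized squares, counted as distinct words; $\mathit{SQ}'_{\mathrm{param}}(n,\sigma)$ is the maximum over such $w$ of the number of pairwise parameterized-nonequivalent parameterized squares occurring as subwords of $w$. -}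

module Defs where

open import Data.Nat using (ℕ; suc)
open import Data.Fin using (Fin)
open import Data.List using (List; []; _∷_; _++_; length)
open import Data.List.Membership.Propositional using (_∈_)
open import Data.List.Relation.Binary.Pointwise using (Pointwise)
open import Data.Product using (Σ; ∃; ∃-syntax; _×_; _,_)
open import Relation.Binary.PropositionalEquality using (_≡_; _≢_)

Word : ℕ → Set
Word σ = List (Fin σ)

-- u and v are equivalent in the parameterized sense:
-- |u| = |v| and there is a bijection f : Alph(u) → Alph(v) with v[t] = f(u[t]) for all t.
-- The bijection is represented by a function f on letters that is injective on Alph(u)
-- and whose restriction to Alph(u) is onto Alph(v).
ParamEquiv : {σ : ℕ} → Word σ → Word σ → Set
ParamEquiv {σ} u v =
  length u ≡ length v ×
  Σ (Fin σ → Fin σ) λ f →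
      (∀ {a b} → a ∈ u → b ∈ u → f a ≡ f b → a ≡ b)
    × (∀ {a} → a ∈ u → f a ∈ v)
    × (∀ {b} → b ∈ v → ∃[ a ] (a ∈ u × f a ≡ b))
    × Pointwise (λ x y → y ≡ f x) u v

IsParamSquare : {σ : ℕ} → Word σ → Set
IsParamSquare {σ} s =
  ∃[ u ] ∃[ v ] (u ≢ [] × v ≢ [] × s ≡ u ++ v × ParamEquiv u v)

IsFactor : {σ : ℕ} → Word σ → Word σ → Set
IsFactor {σ} s w = ∃[ x ] ∃[ y ] (w ≡ x ++ (s ++ y))

-- Attach to a square factor s of w, of half-length a, its rightmost occurrence pos in w up to
-- renaming of letters, the renaming π of the first half of that occurrence onto the second half,
-- and the renaming ρ of s onto the occurrence. If three squares with pairwise distinct half-lengths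
-- a < b < c shared pos and π, the prefix of length 2a of the occurrence would recur, up to
-- renaming, at pos + g with 0 < g and g + 2a ≤ 2c: through π itself when 2a ≤ c, and otherwise
-- because the gaps b − a and c − b force a short period. That contradicts rightmostness. Squares
-- sharing pos and the half-length are equivalent, and equal if they also share ρ, so each of the
-- at most n·σ! values of (pos, π), resp. n·(σ!)² values of (pos, π, ρ), is taken by at most two of
-- the squares counted.

module Submission where

open import Defs
open import Data.Empty using (⊥; ⊥-elim)
open import Data.Fin as Fin using (Fin; zero; suc; toℕ; fromℕ<; combine; punchOut)
open import Data.Fin.Permutation.Components using (transpose; transpose-inverse)
open import Data.Fin.Properties
  using (_≟_; punchOut-injective; combine-injective; toℕ<n; toℕ-injective; toℕ-fromℕ<)
import Data.Fin.Properties as Finₚ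
open import Data.List using (List; []; _∷_; _++_; length; filter)
open import Data.List.Membership.Propositional using (_∈_)
open import Data.List.Properties using (length-++)
open import Data.List.Relation.Binary.Pointwise using (Pointwise; Pointwise-≡⇒≡)
open import Data.List.Relation.Unary.All as All using (All)
import Data.List.Relation.Unary.All.Properties as Allₚ
open import Data.List.Relation.Unary.AllPairs using (AllPairs)
import Data.List.Relation.Unary.AllPairs.Properties as AllPairsₚ
open import Data.List.Relation.Unary.Any using (here; there)
open import Data.List.Relation.Unary.Unique.Propositional using (Unique)
open import Data.Nat
  using (ℕ; zero; suc; _+_; _*_; _^_; _≤_; _<_; _≤?_; _<?_; z≤n; s≤s; z<s; NonZero; _!)
open import Data.Nat.Properties hiding (_≟_; suc-injective)
import Data.Nat.Properties as ℕ
open import Data.Nat.Tactic.RingSolver using (solve; solve-∀)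
open import Data.Product as Product using (∃; ∃-syntax; _×_; _,_; proj₁; proj₂)
open import Data.Sum using (inj₁; inj₂)
open import Function using (_∘_; id; _on_; _⇔_; mk⇔; Equivalence)
open import Function.Definitions using (Injective)
import Function.Properties.Equivalence as ⇔
open import Level using (0ℓ)
open import Relation.Binary using (tri<; tri≈; tri>)
open import Relation.Binary.PropositionalEquality
open import Relation.Nullary using (¬_; Dec; yes; no; contradiction)
open import Relation.Nullary.Decidable using (dec-true; map′; _×-dec_; _→-dec_)
open import Relation.Unary using (Pred; Decidable)
open import Relation.Unary.Properties using (∁?)

open Equivalence using (to; from)

module _ {A : Set} (default : A) where

  -- Constructors of Pointwise, All and AllPairs are opened only locally: overloading [] and _∷_
  -- at top level makes the variable lists given to the ring solver very slow to elaborate.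
  open import Data.List.Relation.Binary.Pointwise using ([]; _∷_)

  nth : List A → ℕ → A
  nth []       _       = default
  nth (x ∷ xs) zero    = x
  nth (x ∷ xs) (suc p) = nth xs p

  nth-∈ : ∀ xs {p} → p < length xs → nth xs p ∈ xs
  nth-∈ (x ∷ xs) {zero}  _         = here refl
  nth-∈ (x ∷ xs) {suc p} (s≤s p<n) = there (nth-∈ xs p<n)

  nth-++ˡ : ∀ xs ys {p} → p < length xs → nth (xs ++ ys) p ≡ nth xs p
  nth-++ˡ (x ∷ xs) ys {zero}  _         = refl
  nth-++ˡ (x ∷ xs) ys {suc p} (s≤s p<n) = nth-++ˡ xs ys p<n

  nth-++ʳ : ∀ xs ys p → nth (xs ++ ys) (length xs + p) ≡ nth ys p
  nth-++ʳ []       ys p = refl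
  nth-++ʳ (x ∷ xs) ys p = nth-++ʳ xs ys p

  Pointwise⇒nth : ∀ {R : A → A → Set} {xs ys} → Pointwise R xs ys →
                  ∀ {p} → p < length xs → R (nth xs p) (nth ys p)
  Pointwise⇒nth (r ∷ _)  {zero}  _         = r
  Pointwise⇒nth (_ ∷ rs) {suc p} (s≤s p<n) = Pointwise⇒nth rs p<n

  nth⇒Pointwise : ∀ {R : A → A → Set} xs ys → length xs ≡ length ys →
                  (∀ {p} → p < length xs → R (nth xs p) (nth ys p)) → Pointwise R xs ys
  nth⇒Pointwise []       []       _  _ = []
  nth⇒Pointwise (x ∷ xs) (y ∷ ys) eq r =
    r (s≤s z≤n) ∷ nth⇒Pointwise xs ys (ℕ.suc-injective eq) (r ∘ s≤s)

SamePattern : {A : Set} → ℕ → (ℕ → A) → (ℕ → A) → Set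
SamePattern m F G = ∀ {p} → p < m → ∀ {q} → q < m → F p ≡ F q ⇔ G p ≡ G q

module _ {A : Set} {m : ℕ} where

  SamePattern-sym : {F G : ℕ → A} → SamePattern m F G → SamePattern m G F
  SamePattern-sym P p<m q<m = ⇔.sym (P p<m q<m)

  SamePattern-trans : {F G H : ℕ → A} → SamePattern m F G → SamePattern m G H → SamePattern m F H
  SamePattern-trans P Q p<m q<m = ⇔.trans (P p<m q<m) (Q p<m q<m)

  SamePattern-≤ : ∀ {m′} {F G : ℕ → A} → m′ ≤ m → SamePattern m F G → SamePattern m′ F G
  SamePattern-≤ m′≤m P p<m′ q<m′ = P (≤-trans p<m′ m′≤m) (≤-trans q<m′ m′≤m)

  SamePattern-image : {F G : ℕ → A} (f : A → A) → Injective _≡_ _≡_ f →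
                      (∀ {t} → t < m → G t ≡ f (F t)) → SamePattern m F G
  SamePattern-image f f-inj G≡fF {p} p<m {q} q<m = mk⇔
    (λ e → trans (G≡fF p<m) (trans (cong f e) (sym (G≡fF q<m))))
    (λ e → f-inj (trans (sym (G≡fF p<m)) (trans e (G≡fF q<m))))

  SamePattern-pointwise : {F G : ℕ → A} → (∀ {t} → t < m → G t ≡ F t) → SamePattern m F G
  SamePattern-pointwise = SamePattern-image id id

SamePattern-shift : ∀ {A : Set} {a} {F G : ℕ → A} → SamePattern (a + a) F G →
                    SamePattern a (F ∘ (a +_)) (G ∘ (a +_))
SamePattern-shift {a = a} P p<a q<a = P (+-monoʳ-< a p<a) (+-monoʳ-< a q<a)

samePattern? : ∀ {σ} m (F G : ℕ → Fin σ) → Dec (SamePattern m F G)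
samePattern? m F G = allUpTo? (λ p → allUpTo? (λ q → (F p ≟ F q) ⇔? (G p ≟ G q)) m) m
  where
  _⇔?_ : ∀ {P Q : Set} → Dec P → Dec Q → Dec (P ⇔ Q)
  P? ⇔? Q? = map′ (λ (P→Q , Q→P) → mk⇔ P→Q Q→P) (λ P⇔Q → to P⇔Q , from P⇔Q)
                  ((P? →-dec Q?) ×-dec (Q? →-dec P?))

module _ {σ : ℕ} where

  transpose-matchˡ : (i j : Fin σ) → transpose i j i ≡ j
  transpose-matchˡ i j rewrite dec-true (i ≟ i) refl = refl

  transpose-fix : (i j k : Fin σ) → k ≡ i ⇔ k ≡ j → transpose i j k ≡ k
  transpose-fix i j k k≡i⇔k≡j with k ≟ i
  ... | yes k≡i = sym (to k≡i⇔k≡j k≡i)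
  ... | no _ with k ≟ j
  ...   | yes k≡j = sym (from k≡i⇔k≡j k≡j)
  ...   | no _ = refl

  transpose-injective : (i j : Fin σ) → Injective _≡_ _≡_ (transpose i j)
  transpose-injective i j {x} {y} e =
    trans (sym (transpose-inverse j i)) (trans (cong (transpose j i) e) (transpose-inverse j i))

  SamePattern⇒renaming : ∀ {m} {F G : ℕ → Fin σ} → SamePattern m F G →
    ∃[ π ] Injective _≡_ _≡_ π × (∀ {t} → t < m → π (F t) ≡ G t)
  SamePattern⇒renaming {zero}  _ = id , id , λ ()
  SamePattern⇒renaming {suc m} {F} {G} P with SamePattern⇒renaming (SamePattern-≤ (n≤1+n m) P)
  ... | π , π-inj , π-maps = transpose A B ∘ π , π-inj ∘ transpose-injective A B , maps
    where
    A = π (F m)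
    B = G m
    maps : ∀ {t} → t < suc m → transpose A B (π (F t)) ≡ G t
    maps {t} t<1+m with m<1+n⇒m<n∨m≡n t<1+m
    ... | inj₂ refl = transpose-matchˡ A B
    ... | inj₁ t<m  = begin
      transpose A B (π (F t)) ≡⟨ cong (transpose A B) (π-maps t<m) ⟩
      transpose A B (G t)     ≡⟨ transpose-fix A B (G t) Gt≡A⇔Gt≡B ⟩
      G t                     ∎
      where
      open ≡-Reasoning
      Ft≡Fm⇔Gt≡Gm : F t ≡ F m ⇔ G t ≡ G m
      Ft≡Fm⇔Gt≡Gm = P t<1+m (n<1+n m)
      Gt≡A⇔Gt≡B : G t ≡ A ⇔ G t ≡ B
      Gt≡A⇔Gt≡B = mk⇔
        (λ e → to Ft≡Fm⇔Gt≡Gm (π-inj (trans (π-maps t<m) e)))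
        (λ e → trans (sym (π-maps t<m)) (cong π (from Ft≡Fm⇔Gt≡Gm e)))

-- Parameterized equivalence as equality of patterns

module _ {k : ℕ} where

  infixl 9 _‼_
  _‼_ : Word (suc k) → ℕ → Fin (suc k)
  _‼_ = nth Fin.zero

  firstIndex : Fin (suc k) → Word (suc k) → ℕ
  firstIndex x []       = zero
  firstIndex x (y ∷ ys) with x ≟ y
  ... | yes _ = zero
  ... | no  _ = suc (firstIndex x ys)

  firstIndex-∈ : ∀ {x} u → x ∈ u → firstIndex x u < length u × u ‼ firstIndex x u ≡ x
  firstIndex-∈ {x} (y ∷ ys) x∈u with x ≟ y | x∈u
  ... | yes x≡y | _          = s≤s z≤n , sym x≡y
  ... | no  x≢y | here x≡y   = ⊥-elim (x≢y x≡y)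
  ... | no  _   | there x∈ys = Product.map s≤s id (firstIndex-∈ ys x∈ys)

  ParamEquiv⇒SamePattern : ∀ {u v} → ParamEquiv u v → SamePattern (length u) (u ‼_) (v ‼_)
  ParamEquiv⇒SamePattern {u} {v} (_ , f , f-inj , _ , _ , v≡fu) {p} p<n {q} q<n = mk⇔
    (λ e → trans (vt≡fut p<n) (trans (cong f e) (sym (vt≡fut q<n))))
    (λ e → f-inj (nth-∈ _ u p<n) (nth-∈ _ u q<n) (trans (sym (vt≡fut p<n)) (trans e (vt≡fut q<n))))
    where
    vt≡fut : ∀ {t} → t < length u → v ‼ t ≡ f (u ‼ t)
    vt≡fut = Pointwise⇒nth _ v≡fu

  -- The bijection Alph(u) → Alph(v) sends a letter to the letter of v at its first position in u.
  SamePattern⇒ParamEquiv : ∀ u v → length u ≡ length v → SamePattern (length u) (u ‼_) (v ‼_) →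
                           ParamEquiv u v
  SamePattern⇒ParamEquiv u v |u|≡|v| P = |u|≡|v| , f , f-inj , f-into , f-onto , v≡fu
    where
    f : Fin (suc k) → Fin (suc k)
    f x = v ‼ firstIndex x u
    f-‼ : ∀ {t} → t < length u → f (u ‼ t) ≡ v ‼ t
    f-‼ t<n with firstIndex-∈ u (nth-∈ _ u t<n)
    ... | i<n , u‼i≡u‼t = to (P i<n t<n) u‼i≡u‼t
    f-inj : ∀ {a b} → a ∈ u → b ∈ u → f a ≡ f b → a ≡ b
    f-inj {a} {b} a∈u b∈u fa≡fb with firstIndex-∈ u a∈u | firstIndex-∈ u b∈u
    ... | i<n , u‼i≡a | j<n , u‼j≡b = trans (sym u‼i≡a) (trans (from (P i<n j<n) fa≡fb) u‼j≡b)
    f-into : ∀ {a} → a ∈ u → f a ∈ v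
    f-into {a} a∈u = nth-∈ _ v (subst (firstIndex a u <_) |u|≡|v| (proj₁ (firstIndex-∈ u a∈u)))
    f-onto : ∀ {b} → b ∈ v → ∃[ a ] (a ∈ u × f a ≡ b)
    f-onto {b} b∈v with firstIndex-∈ v b∈v
    ... | i<|v| , v‼i≡b = u ‼ i , nth-∈ _ u i<|u| , trans (f-‼ i<|u|) v‼i≡b
      where
      i = firstIndex b v
      i<|u| : i < length u
      i<|u| = subst (i <_) (sym |u|≡|v|) i<|v|
    v≡fu : Pointwise (λ x y → y ≡ f x) u v
    v≡fu = nth⇒Pointwise _ u v |u|≡|v| (sym ∘ f-‼)

-- Lehmer codes of permutations

module _ {m : ℕ} (π : Fin (suc m) → Fin (suc m)) (π-inj : Injective _≡_ _≡_ π) where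

  π0≢π[1+j] : ∀ j → π zero ≢ π (suc j)
  π0≢π[1+j] j π0≡π[1+j] = Finₚ.0≢1+n (π-inj π0≡π[1+j])

  removeZero : Fin m → Fin m
  removeZero j = punchOut (π0≢π[1+j] j)

  removeZero-injective : Injective _≡_ _≡_ removeZero
  removeZero-injective {i} {j} e =
    Finₚ.suc-injective (π-inj (punchOut-injective (π0≢π[1+j] i) (π0≢π[1+j] j) e))

permutationCode : ∀ σ (π : Fin σ → Fin σ) → Injective _≡_ _≡_ π → Fin (σ !)
permutationCode zero    π π-inj = zero
permutationCode (suc m) π π-inj =
  combine (π zero) (permutationCode m (removeZero π π-inj) (removeZero-injective π π-inj))

punchOut-injective′ : ∀ {n} {i i′ j j′ : Fin (suc n)} (i≢j : i ≢ j) (i′≢j′ : i′ ≢ j′) →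
                      i ≡ i′ → punchOut i≢j ≡ punchOut i′≢j′ → j ≡ j′
punchOut-injective′ i≢j i′≢j′ refl = punchOut-injective i≢j i′≢j′

permutationCode-injective : ∀ σ {π ρ : Fin σ → Fin σ}
  (π-inj : Injective _≡_ _≡_ π) (ρ-inj : Injective _≡_ _≡_ ρ) →
  permutationCode σ π π-inj ≡ permutationCode σ ρ ρ-inj → ∀ x → π x ≡ ρ x
permutationCode-injective (suc m) π-inj ρ-inj codes≡ zero = proj₁ (combine-injective _ _ _ _ codes≡)
permutationCode-injective (suc m) {π} {ρ} π-inj ρ-inj codes≡ (suc x) =
  punchOut-injective′ (π0≢π[1+j] π π-inj x) (π0≢π[1+j] ρ ρ-inj x) (proj₁ heads&tails≡)
    (permutationCode-injective m (removeZero-injective π π-inj) (removeZero-injective ρ ρ-inj)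
      (proj₂ heads&tails≡) x)
  where heads&tails≡ = combine-injective _ _ _ _ codes≡

-- Three squares with a common renaming

m<m+n⇒0<n : ∀ {m n} → m < m + n → 0 < n
m<m+n⇒0<n {m} {zero}  m<m+0 = contradiction (subst (m <_) (+-identityʳ m) m<m+0) (n≮n m)
m<m+n⇒0<n {m} {suc n} _     = z<s

module _ {A : Set} (U : ℕ → A) where

  Square : (A → A) → ℕ → Set
  Square π a = ∀ {t} → t < a → U (a + t) ≡ π (U t)

  HasPeriod : ℕ → ℕ → Set
  HasPeriod p L = ∀ {t} → p + t < L → U (p + t) ≡ U t

  module _ {π : A → A} (π-inj : Injective _≡_ _≡_ π) where

    squares⇒period : ∀ {a d} → Square π a → Square π (a + d) → HasPeriod d a
    squares⇒period {a} {d} sq-a sq-a+d {t} d+t<a = π-inj (begin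
      π (U (d + t))   ≡⟨ sq-a d+t<a ⟨
      U (a + (d + t)) ≡⟨ cong U (+-assoc a d t) ⟨
      U (a + d + t)   ≡⟨ sq-a+d t<a+d ⟩
      π (U t)         ∎)
      where
      open ≡-Reasoning
      t<a+d : t < a + d
      t<a+d = <-≤-trans (≤-<-trans (m≤n+m t d) d+t<a) (m≤m+n a d)

    -- The square at b carries the period g of U[0,b) over to U[b,2b); where g + t straddles b,
    -- comparing the squares at a and b leaves exactly the hypothesis U (r + x) ≡ U x.
    period-spread : ∀ {a g r} → Square π a → Square π (a + (g + r)) → HasPeriod g (a + (g + r)) →
                    (∀ {x} → x < g → U (r + x) ≡ U x) → HasPeriod g (g + (a + a))
    period-spread {a} {g} {r} sq-a sq-b per shift {t} g+t<g+2a
      with g + t <? a + (g + r) | a + (g + r) ≤? t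
    ... | yes g+t<b | _       = per g+t<b
    ... | no _      | yes b≤t = beyond-b (m≤n⇒∃[o]m+o≡n b≤t) (+-cancelˡ-< g _ _ g+t<g+2a)
      where
      open ≡-Reasoning
      beyond-b : ∀ {t} → ∃[ s ] a + (g + r) + s ≡ t → t < a + a → U (g + t) ≡ U t
      beyond-b (s , refl) b+s<2a = begin
        U (g + (a + (g + r) + s)) ≡⟨ cong U (solve (g ∷ a ∷ r ∷ s ∷ [])) ⟩
        U (a + (g + r) + (g + s)) ≡⟨ sq-b g+s<b ⟩
        π (U (g + s))             ≡⟨ cong π (per g+s<b) ⟩
        π (U s)                   ≡⟨ sq-b s<b ⟨
        U (a + (g + r) + s)       ∎
        where
        s<a : s < a
        s<a = +-cancelˡ-< a s a (≤-<-trans (+-monoˡ-≤ s (m≤m+n a (g + r))) b+s<2a)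
        g+s<b : g + s < a + (g + r)
        g+s<b = <-≤-trans (+-monoʳ-< g s<a)
                          (subst (_≤ a + (g + r)) (+-comm a g) (+-monoʳ-≤ a (m≤m+n g r)))
        s<b : s < a + (g + r)
        s<b = <-≤-trans s<a (m≤m+n a (g + r))
    ... | no g+t≮b  | no b≰t  =
      across-b (m≤n⇒∃[o]m+o≡n a+r≤t) (≰⇒> b≰t) (+-cancelˡ-< g _ _ g+t<g+2a)
      where
      open ≡-Reasoning
      b≡g+[a+r] : a + (g + r) ≡ g + (a + r)
      b≡g+[a+r] = solve (a ∷ g ∷ r ∷ [])
      a+r≤t : a + r ≤ t
      a+r≤t = +-cancelˡ-≤ g _ _ (subst (_≤ g + t) b≡g+[a+r] (≮⇒≥ g+t≮b))
      across-b : ∀ {t} → ∃[ x ] a + r + x ≡ t → t < a + (g + r) → t < a + a → U (g + t) ≡ U t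
      across-b (x , refl) t<b t<2a = begin
        U (g + (a + r + x)) ≡⟨ cong U (solve (g ∷ a ∷ r ∷ x ∷ [])) ⟩
        U (a + (g + r) + x) ≡⟨ sq-b x<b ⟩
        π (U x)             ≡⟨ cong π (shift x<g) ⟨
        π (U (r + x))       ≡⟨ sq-a r+x<a ⟨
        U (a + (r + x))     ≡⟨ cong U (+-assoc a r x) ⟨
        U (a + r + x)       ∎
        where
        b≡a+r+g : a + (g + r) ≡ a + r + g
        b≡a+r+g = solve (a ∷ g ∷ r ∷ [])
        x<g : x < g
        x<g = +-cancelˡ-< (a + r) x g (subst (a + r + x <_) b≡a+r+g t<b)
        x<b : x < a + (g + r)
        x<b = <-≤-trans x<g (≤-trans (m≤m+n g r) (m≤n+m (g + r) a))
        r+x<a : r + x < a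
        r+x<a = +-cancelˡ-< a (r + x) a (subst (_< a + a) (+-assoc a r x) t<2a)

    period-extend : ∀ {a d e} → HasPeriod d a → HasPeriod e (a + d) → d < e → d + e < a →
                    HasPeriod d (a + d)
    period-extend {a} {d} {e} per-d per-e d<e d+e<a {t} d+t<a+d with d + t <? a
    ... | yes d+t<a = per-d d+t<a
    ... | no  d+t≮a = beyond-e (m≤n⇒∃[o]m+o≡n e≤t) t<a
      where
      open ≡-Reasoning
      t<a : t < a
      t<a = +-cancelˡ-< d t a (subst (d + t <_) (+-comm a d) d+t<a+d)
      e≤t : e ≤ t
      e≤t = <⇒≤ (+-cancelˡ-< d e t (<-≤-trans d+e<a (≮⇒≥ d+t≮a)))
      beyond-e : ∀ {t} → ∃[ s ] e + s ≡ t → t < a → U (d + t) ≡ U t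
      beyond-e (s , refl) e+s<a = begin
        U (d + (e + s)) ≡⟨ cong U (solve (d ∷ e ∷ s ∷ [])) ⟩
        U (e + (d + s)) ≡⟨ per-e e+[d+s]<a+d ⟩
        U (d + s)       ≡⟨ per-d d+s<a ⟩
        U s             ≡⟨ per-e e+s<a+d ⟨
        U (e + s)       ∎
        where
        e+s+d≡e+[d+s] : e + s + d ≡ e + (d + s)
        e+s+d≡e+[d+s] = solve (e ∷ s ∷ d ∷ [])
        e+[d+s]<a+d : e + (d + s) < a + d
        e+[d+s]<a+d = subst (_< a + d) e+s+d≡e+[d+s] (+-monoˡ-< d e+s<a)
        d+s<a : d + s < a
        d+s<a = <-trans (+-monoˡ-< s d<e) e+s<a
        e+s<a+d : e + s < a + d
        e+s<a+d = <-≤-trans e+s<a (m≤m+n a d)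

    three-squares⇒period : ∀ {a d e} → Square π a → Square π (a + d) → Square π (a + d + e) →
                           0 < d → 0 < e → d + e < a →
                           ∃[ g ] 0 < g × g ≤ d × HasPeriod g (g + (a + a))
    three-squares⇒period {a} {d} {e} sq-a sq-a+d sq-a+d+e 0<d 0<e d+e<a with e ≤? d
    ... | no e≰d = d , 0<d , ≤-refl ,
      period-spread sq-a (subst (λ z → Square π (a + z)) (sym (+-identityʳ d)) sq-a+d)
        (subst (λ z → HasPeriod d (a + z)) (sym (+-identityʳ d))
               (period-extend per-d per-e (≰⇒> e≰d) d+e<a))
        (λ _ → refl)
      where
      per-d = squares⇒period sq-a sq-a+d
      per-e = squares⇒period sq-a+d sq-a+d+e
    ... | yes e≤d with m≤n⇒∃[o]m+o≡n e≤d
    ...   | r , refl = e , 0<e , m≤m+n e r , period-spread sq-a sq-a+d per-e shift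
      where
      open ≡-Reasoning
      per-d = squares⇒period sq-a sq-a+d
      per-e = squares⇒period sq-a+d sq-a+d+e
      shift : ∀ {x} → x < e → U (r + x) ≡ U x
      shift {x} x<e = begin
        U (r + x)       ≡⟨ per-e e+[r+x]<a+[e+r] ⟨
        U (e + (r + x)) ≡⟨ cong U (+-assoc e r x) ⟨
        U (e + r + x)   ≡⟨ per-d (<-trans (+-monoʳ-< (e + r) x<e) d+e<a) ⟩
        U x             ∎
        where
        e+[r+x]<a+[e+r] : e + (r + x) < a + (e + r)
        e+[r+x]<a+[e+r] = <-≤-trans
          (subst (_< a) (+-assoc e r x) (<-trans (+-monoʳ-< (e + r) x<e) d+e<a)) (m≤m+n a (e + r))

    prefix-recurs : ∀ {a b c} → Square π a → Square π b → Square π c → a < b → b < c →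
                    ∃[ g ] 0 < g × g + (a + a) ≤ c + c × SamePattern (a + a) U (λ t → U (g + t))
    prefix-recurs {a} {b} {c} sq-a sq-b sq-c a<b b<c with a + a ≤? c
    ... | yes 2a≤c = c , m<n⇒0<n (<-trans a<b b<c) , +-monoʳ-≤ c 2a≤c ,
          SamePattern-image π π-inj (λ t<2a → sq-c (<-≤-trans t<2a 2a≤c))
    ... | no 2a≰c with m≤n⇒∃[o]m+o≡n (<⇒≤ a<b) | m≤n⇒∃[o]m+o≡n (<⇒≤ b<c)
    ...   | d , refl | e , refl
      with three-squares⇒period sq-a sq-b sq-c (m<m+n⇒0<n a<b) (m<m+n⇒0<n b<c) d+e<a
      where
      d+e<a : d + e < a
      d+e<a = +-cancelˡ-< a _ _ (subst (_< a + a) (+-assoc a d e) (≰⇒> 2a≰c))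
    ...     | g , 0<g , g≤d , per = g , 0<g , g+2a≤2c ,
              SamePattern-pointwise (λ t<2a → per (+-monoʳ-< g t<2a))
      where
      g+2a≤2c : g + (a + a) ≤ a + d + e + (a + d + e)
      g+2a≤2c = begin
        g + (a + a)             ≤⟨ +-monoˡ-≤ (a + a) g≤d ⟩
        d + (a + a)             ≡⟨ solve (d ∷ a ∷ []) ⟩
        a + d + a               ≤⟨ +-mono-≤ (m≤m+n (a + d) e) (≤-trans (m≤m+n a d) (m≤m+n (a + d) e)) ⟩
        a + d + e + (a + d + e) ∎
        where open ≤-Reasoning

-- Counting at most two elements per key

module _ {X : Set} where

  open import Data.List.Relation.Unary.All using ([]; _∷_)
  open import Data.List.Relation.Unary.AllPairs using ([]; _∷_)

  length-filter+filter∁ : ∀ {P : Pred X 0ℓ} (P? : Decidable P) xs →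
                          length (filter P? xs) + length (filter (∁? P?) xs) ≡ length xs
  length-filter+filter∁ P? []       = refl
  length-filter+filter∁ P? (x ∷ xs) with P? x
  ... | yes _ = cong suc (length-filter+filter∁ P? xs)
  ... | no  _ = trans (+-suc _ _) (cong suc (length-filter+filter∁ P? xs))

  length-toList : ∀ {P : X → Set} {xs} (pxs : All P xs) → length (All.toList pxs) ≡ length xs
  length-toList []        = refl
  length-toList (_ ∷ pxs) = cong suc (length-toList pxs)

  All-toList : ∀ {P Q : X → Set} {xs} → All Q xs → (pxs : All P xs) →
               All (Q ∘ proj₁) (All.toList pxs)
  All-toList []       []        = []
  All-toList (q ∷ qs) (_ ∷ pxs) = q ∷ All-toList qs pxs

  AllPairs-toList : ∀ {P : X → Set} {R : X → X → Set} {xs} → AllPairs R xs → (pxs : All P xs) →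
                    AllPairs (R on proj₁) (All.toList pxs)
  AllPairs-toList []         []        = []
  AllPairs-toList (rs ∷ rss) (_ ∷ pxs) = All-toList rs pxs ∷ AllPairs-toList rss pxs

module _ {X : Set} {R : X → X → Set} (key : X → ℕ)
         (no-triple : ∀ {x y z} → key x ≡ key y → key y ≡ key z → R x y → R x z → R y z → ⊥) where

  open import Data.List.Relation.Unary.All using ([]; _∷_)
  open import Data.List.Relation.Unary.AllPairs using ([]; _∷_)

  length≤2 : ∀ {k ys} → All (λ y → key y ≡ k) ys → AllPairs R ys → length ys ≤ 2
  length≤2 {ys = []}             _ _ = z≤n
  length≤2 {ys = _ ∷ []}         _ _ = s≤s z≤n
  length≤2 {ys = _ ∷ _ ∷ []}     _ _ = s≤s (s≤s z≤n)
  length≤2 {ys = _ ∷ _ ∷ _ ∷ _} (kx ∷ ky ∷ kz ∷ _) ((Rxy ∷ Rxz ∷ _) ∷ (Ryz ∷ _) ∷ _) =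
    ⊥-elim (no-triple (trans kx (sym ky)) (trans ky (sym kz)) Rxy Rxz Ryz)

  length≤2*bound : ∀ N {xs} → All (λ x → key x < N) xs → AllPairs R xs → length xs ≤ 2 * N
  length≤2*bound zero    {[]}    []      _     = z≤n
  length≤2*bound (suc N) {xs}    bounded pairs = begin
    length xs                                              ≡⟨ length-filter+filter∁ top? xs ⟨
    length (filter top? xs) + length (filter (∁? top?) xs) ≤⟨ +-mono-≤ top≤2 rest≤2N ⟩
    2 + 2 * N                                              ≡⟨ *-suc 2 N ⟨
    2 * suc N                                              ∎
    where
    open ≤-Reasoning
    top? = λ x → key x ℕ.≟ N
    top≤2 = length≤2 (Allₚ.all-filter top? xs) (AllPairsₚ.filter⁺ top? pairs)
    rest≤2N = length≤2*bound N
      (All.zipWith (λ (k<1+N , k≢N) → ≤∧≢⇒< (m<1+n⇒m≤n k<1+N) k≢N)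
        (Allₚ.filter⁺ (∁? top?) bounded , Allₚ.all-filter (∁? top?) xs))
      (AllPairsₚ.filter⁺ (∁? top?) pairs)

module _ {X : Set} (key size : X → ℕ)
         (no-increasing : ∀ {x y z} → key x ≡ key y → key y ≡ key z →
                          size x < size y → size y < size z → ⊥) where

  no-three-distinct : ∀ {x y z} → key x ≡ key y → key y ≡ key z →
                      size x ≢ size y → size y ≢ size z → size x ≢ size z → ⊥
  no-three-distinct {x} {y} {z} kxy kyz hx≢hy hy≢hz hx≢hz
    with <-cmp (size x) (size y) | <-cmp (size y) (size z) | <-cmp (size x) (size z)
  ... | tri≈ _ e _   | _            | _            = hx≢hy e
  ... | _            | tri≈ _ e _   | _            = hy≢hz e
  ... | _            | _            | tri≈ _ e _   = hx≢hz e
  ... | tri< x<y _ _ | tri< y<z _ _ | _            = no-increasing kxy kyz x<y y<z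
  ... | tri< x<y _ _ | tri> _ _ z<y | tri< x<z _ _ = no-increasing (trans kxy kyz) (sym kyz) x<z z<y
  ... | tri< x<y _ _ | tri> _ _ z<y | tri> _ _ z<x = no-increasing (sym (trans kxy kyz)) kxy z<x x<y
  ... | tri> _ _ y<x | tri< y<z _ _ | tri< x<z _ _ = no-increasing (sym kxy) (trans kxy kyz) y<x x<z
  ... | tri> _ _ y<x | tri< y<z _ _ | tri> _ _ z<x = no-increasing kyz (sym (trans kxy kyz)) y<z z<x
  ... | tri> _ _ y<x | tri> _ _ z<y | _            = no-increasing (sym kyz) (sym kxy) z<y y<x

-- The rightmost occurrence of a square factor

greatest : ∀ {P : ℕ → Set} → Decidable P → ∀ {j} m → j ≤ m → P j →
           ∃[ i ] P i × (∀ {k} → i < k → k ≤ m → ¬ P k)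
greatest P? m j≤m Pj with P? m
... | yes Pm = m , Pm , λ m<k k≤m _ → <⇒≱ m<k k≤m
greatest P? zero    z≤n   Pj | no ¬P0 = ⊥-elim (¬P0 Pj)
greatest {P} P? (suc m) j≤1+m Pj | no ¬P[1+m] with m≤n⇒m<n∨m≡n j≤1+m
... | inj₂ refl  = ⊥-elim (¬P[1+m] Pj)
... | inj₁ j<1+m with greatest P? m (m<1+n⇒m≤n j<1+m) Pj
...   | i , Pi , none-above = i , Pi , above-i
  where
  above-i : ∀ {k} → i < k → k ≤ suc m → ¬ P k
  above-i i<k k≤1+m with m≤n⇒m<n∨m≡n k≤1+m
  ... | inj₁ k<1+m = none-above i<k (m<1+n⇒m≤n k<1+m)
  ... | inj₂ refl  = ¬P[1+m]

module _ {k : ℕ} where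

  square-halves : ∀ {s : Word (suc k)} → IsParamSquare s →
    ∃[ a ] 0 < a × length s ≡ a + a × SamePattern a (s ‼_) (λ t → s ‼ (a + t))
  square-halves (u , v , u≢[] , _ , refl , u≈v) =
    length u , 0<|u| u≢[] , |uv|≡2|u| ,
    SamePattern-trans (SamePattern-pointwise (λ t<|u| → sym (nth-++ˡ _ u v t<|u|)))
      (SamePattern-trans (ParamEquiv⇒SamePattern u≈v)
        (SamePattern-pointwise (λ {t} _ → nth-++ʳ _ u v t)))
    where
    0<|u| : ∀ {u : Word (suc k)} → u ≢ [] → 0 < length u
    0<|u| {[]}    u≢[] = ⊥-elim (u≢[] refl)
    0<|u| {_ ∷ _} _    = z<s
    |uv|≡2|u| : length (u ++ v) ≡ length u + length u
    |uv|≡2|u| = trans (length-++ u) (cong (length u +_) (sym (proj₁ u≈v)))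

module _ {k : ℕ} (w : Word (suc k)) where

  OccursAt : Word (suc k) → ℕ → Set
  OccursAt s j = j + length s ≤ length w × SamePattern (length s) (s ‼_) (λ p → w ‼ (j + p))

  occursAt? : ∀ s → Decidable (OccursAt s)
  occursAt? s j =
    (j + length s ≤? length w) ×-dec samePattern? (length s) (s ‼_) (λ p → w ‼ (j + p))

  factor-occurs : ∀ {s} → IsFactor s w → ∃[ j ] OccursAt s j
  factor-occurs {s} (x , y , refl) = length x , fits , SamePattern-pointwise xsy‼≡s‼
    where
    fits : length x + length s ≤ length (x ++ (s ++ y))
    fits = subst (length x + length s ≤_)
      (sym (trans (length-++ x) (cong (length x +_) (length-++ s))))
      (+-monoʳ-≤ (length x) (m≤m+n (length s) (length y)))
    xsy‼≡s‼ : ∀ {p} → p < length s → (x ++ (s ++ y)) ‼ (length x + p) ≡ s ‼ p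
    xsy‼≡s‼ {p} p<|s| = trans (nth-++ʳ _ x (s ++ y) p) (nth-++ˡ _ s y p<|s|)

  record Anchor (s : Word (suc k)) : Set where
    field
      half        : ℕ
      0<half      : 0 < half
      |s|≡2half   : length s ≡ half + half
      pos         : ℕ
      occurs      : OccursAt s pos
      rightmost   : ∀ {j} → pos < j → ¬ OccursAt s j
      π           : Fin (suc k) → Fin (suc k)
      π-injective : Injective _≡_ _≡_ π
      square      : Square (λ t → w ‼ (pos + t)) π half
      ρ           : Fin (suc k) → Fin (suc k)
      ρ-injective : Injective _≡_ _≡_ ρ
      ρ-maps      : ∀ {p} → p < length s → ρ (s ‼ p) ≡ w ‼ (pos + p)

  occurrence-square : ∀ {s i a} → OccursAt s i → length s ≡ a + a →
    SamePattern a (s ‼_) (λ t → s ‼ (a + t)) →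
    ∃[ π ] Injective _≡_ _≡_ π × Square (λ t → w ‼ (i + t)) π a
  occurrence-square {s} {i} {a} occurs |s|≡2a halves =
    let π , π-inj , π-maps = SamePattern⇒renaming first≈second in π , π-inj , sym ∘ π-maps
    where
    s≈w : SamePattern (a + a) (s ‼_) (λ p → w ‼ (i + p))
    s≈w = subst (λ m → SamePattern m (s ‼_) (λ p → w ‼ (i + p))) |s|≡2a (proj₂ occurs)
    first≈second : SamePattern a (λ t → w ‼ (i + t)) (λ t → w ‼ (i + (a + t)))
    first≈second = SamePattern-trans (SamePattern-sym (SamePattern-≤ (m≤m+n a a) s≈w))
                                     (SamePattern-trans halves (SamePattern-shift s≈w))

  anchor : ∀ {s} → IsFactor s w × IsParamSquare s → Anchor s
  anchor {s} (factor , sq) with factor-occurs {s} factor | square-halves {s = s} sq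
  ... | j , occurs-j | a , 0<a , |s|≡2a , halves
    with greatest (occursAt? s) (length w) (m+n≤o⇒m≤o j (proj₁ occurs-j)) occurs-j
  ...   | i , occurs-i , none-above
    with occurrence-square {s} occurs-i |s|≡2a halves | SamePattern⇒renaming (proj₂ occurs-i)
  ...     | π , π-inj , sq-i | ρ , ρ-inj , ρ-maps = record
    { half        = a
    ; 0<half      = 0<a
    ; |s|≡2half   = |s|≡2a
    ; pos         = i
    ; occurs      = occurs-i
    ; rightmost   = λ i<j occurs-j → none-above i<j (m+n≤o⇒m≤o _ (proj₁ occurs-j)) occurs-j
    ; π           = π
    ; π-injective = π-inj
    ; square      = sq-i
    ; ρ           = ρ
    ; ρ-injective = ρ-inj
    ; ρ-maps      = ρ-maps
    }

  open Anchor

  Anchored : Set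
  Anchored = ∃ Anchor

  halfLength : Anchored → ℕ
  halfLength (_ , A) = half A

  SameAnchor : Anchored → Anchored → Set
  SameAnchor (_ , A) (_ , B) = pos A ≡ pos B × (∀ c → π A c ≡ π B c)

  transport-square : ∀ {x y} → SameAnchor x y →
    Square (λ t → w ‼ (pos (proj₂ x) + t)) (π (proj₂ x)) (halfLength y)
  transport-square {_ , A} {_ , B} (pos≡ , π≗) {t} t<b = begin
    w ‼ (pos A + (half B + t)) ≡⟨ cong (λ i → w ‼ (i + (half B + t))) pos≡ ⟩
    w ‼ (pos B + (half B + t)) ≡⟨ square B t<b ⟩
    π B (w ‼ (pos B + t))      ≡⟨ π≗ _ ⟨
    π A (w ‼ (pos B + t))      ≡⟨ cong (λ i → π A (w ‼ (i + t))) pos≡ ⟨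
    π A (w ‼ (pos A + t))      ∎
    where open ≡-Reasoning

  no-nested-triple : ∀ {x y z} → SameAnchor x y → SameAnchor x z →
                     halfLength x < halfLength y → halfLength y < halfLength z → ⊥
  no-nested-triple {s , A} {t , B} {u , C} x~y x~z a<b b<c
    with prefix-recurs (λ t → w ‼ (pos A + t)) (π-injective A) (square A)
           (transport-square {s , A} {t , B} x~y) (transport-square {s , A} {u , C} x~z) a<b b<c
  ... | g , 0<g , g+2a≤2c , recurs = rightmost A (m<m+n (pos A) 0<g) (fits , s≈w)
    where
    fits : pos A + g + length s ≤ length w
    fits = begin
      pos A + g + length s            ≡⟨ cong (pos A + g +_) (|s|≡2half A) ⟩
      pos A + g + (half A + half A)   ≡⟨ +-assoc (pos A) g _ ⟩
      pos A + (g + (half A + half A)) ≤⟨ +-monoʳ-≤ (pos A) g+2a≤2c ⟩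
      pos A + (half C + half C)       ≡⟨ cong₂ _+_ (proj₁ x~z) (sym (|s|≡2half C)) ⟩
      pos C + length u                ≤⟨ proj₁ (occurs C) ⟩
      length w                        ∎
      where open ≤-Reasoning
    s≈w : SamePattern (length s) (s ‼_) (λ p → w ‼ (pos A + g + p))
    s≈w = SamePattern-trans (proj₂ (occurs A))
      (SamePattern-trans (subst (λ m → SamePattern m _ _) (sym (|s|≡2half A)) recurs)
        (SamePattern-pointwise (λ {p} _ → cong (w ‼_) (+-assoc (pos A) g p))))

  same-half⇒ParamEquiv : ∀ {x y} → SameAnchor x y → halfLength x ≡ halfLength y →
                         ParamEquiv (proj₁ x) (proj₁ y)
  same-half⇒ParamEquiv {s , A} {t , B} (pos≡ , _) a≡b = SamePattern⇒ParamEquiv s t |s|≡|t|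
    (SamePattern-trans (proj₂ (occurs A)) (SamePattern-sym t≈w))
    where
    |s|≡|t| : length s ≡ length t
    |s|≡|t| = trans (|s|≡2half A) (trans (cong (λ h → h + h) a≡b) (sym (|s|≡2half B)))
    t≈w : SamePattern (length s) (t ‼_) (λ p → w ‼ (pos A + p))
    t≈w = subst₂ (λ m i → SamePattern m (t ‼_) (λ p → w ‼ (i + p))) (sym |s|≡|t|) (sym pos≡)
                 (proj₂ (occurs B))

  same-half⇒≡ : ∀ {x y} → SameAnchor x y → (∀ c → ρ (proj₂ x) c ≡ ρ (proj₂ y) c) →
                halfLength x ≡ halfLength y → proj₁ x ≡ proj₁ y
  same-half⇒≡ {s , A} {t , B} (pos≡ , _) ρ≗ a≡b =
    Pointwise-≡⇒≡ (nth⇒Pointwise _ s t |s|≡|t| λ {p} p<|s| → ρ-injective A (begin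
      ρ A (s ‼ p)     ≡⟨ ρ-maps A p<|s| ⟩
      w ‼ (pos A + p) ≡⟨ cong (λ i → w ‼ (i + p)) pos≡ ⟩
      w ‼ (pos B + p) ≡⟨ ρ-maps B (subst (p <_) |s|≡|t| p<|s|) ⟨
      ρ B (t ‼ p)     ≡⟨ ρ≗ _ ⟨
      ρ A (t ‼ p)     ∎))
    where
    open ≡-Reasoning
    |s|≡|t| : length s ≡ length t
    |s|≡|t| = trans (|s|≡2half A) (trans (cong (λ h → h + h) a≡b) (sym (|s|≡2half B)))

  pos<|w| : ∀ {s} (A : Anchor s) → pos A < length w
  pos<|w| {s} A = <-≤-trans (m<m+n (pos A) 0<|s|) (proj₁ (occurs A))
    where
    0<|s| : 0 < length s
    0<|s| = subst (0 <_) (sym (|s|≡2half A)) (<-≤-trans (0<half A) (m≤m+n _ _))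

  anchorCode : Anchored → Fin (length w * suc k !)
  anchorCode (_ , A) = combine (fromℕ< (pos<|w| A)) (permutationCode _ (π A) (π-injective A))

  anchorCode-injective : ∀ x y → anchorCode x ≡ anchorCode y → SameAnchor x y
  anchorCode-injective (_ , A) (_ , B) codes≡ with combine-injective _ _ _ _ codes≡
  ... | pos≡ , π≡ =
    trans (sym (toℕ-fromℕ< (pos<|w| A))) (trans (cong toℕ pos≡) (toℕ-fromℕ< (pos<|w| B))) ,
    permutationCode-injective _ (π-injective A) (π-injective B) π≡

  anchorCode⁺ : Anchored → Fin (length w * suc k ! * suc k !)
  anchorCode⁺ x@(_ , A) = combine (anchorCode x) (permutationCode _ (ρ A) (ρ-injective A))

  anchorCode⁺-injective : ∀ x y → anchorCode⁺ x ≡ anchorCode⁺ y →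
                          SameAnchor x y × (∀ c → ρ (proj₂ x) c ≡ ρ (proj₂ y) c)
  anchorCode⁺-injective x@(_ , A) y@(_ , B) codes≡ with combine-injective _ _ _ _ codes≡
  ... | anchors≡ , ρ≡ =
    anchorCode-injective x y anchors≡ ,
    permutationCode-injective _ (ρ-injective A) (ρ-injective B) ρ≡

  count-squares : ∀ {R : Word (suc k) → Word (suc k) → Set} {N} (key : Anchored → Fin N) →
    (∀ x y → key x ≡ key y → SameAnchor x y) →
    (∀ x y → key x ≡ key y → R (proj₁ x) (proj₁ y) → halfLength x ≢ halfLength y) →
    ∀ {L} → All (λ s → IsFactor s w × IsParamSquare s) L → AllPairs R L → length L ≤ 2 * N
  count-squares {R} {N} key same-anchor distinct squares pairs =
    subst (_≤ 2 * N) (length-toList anchors)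
      (length≤2*bound (toℕ ∘ key) no-triple N (All.universal (toℕ<n ∘ key) _)
        (AllPairs-toList pairs anchors))
    where
    anchors = All.map anchor squares
    same-anchor′ : ∀ {x y} → toℕ (key x) ≡ toℕ (key y) → SameAnchor x y
    same-anchor′ {x} {y} = same-anchor x y ∘ toℕ-injective
    no-triple : ∀ {x y z} → toℕ (key x) ≡ toℕ (key y) → toℕ (key y) ≡ toℕ (key z) →
                R (proj₁ x) (proj₁ y) → R (proj₁ x) (proj₁ z) → R (proj₁ y) (proj₁ z) → ⊥
    no-triple {x} {y} {z} kxy kyz Rxy Rxz Ryz =
      no-three-distinct (toℕ ∘ key) halfLength
        (λ {u} {v} {t} kuv kvt →
          no-nested-triple {u} {v} {t} (same-anchor′ kuv) (same-anchor′ (trans kuv kvt)))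
        kxy kyz
        (distinct x y (toℕ-injective kxy) Rxy)
        (distinct y z (toℕ-injective kyz) Ryz)
        (distinct x z (toℕ-injective (trans kxy kyz)) Rxz)

  nonequivalent-squares-bound : ∀ {L} → All (λ s → IsFactor s w × IsParamSquare s) L →
    AllPairs (λ s t → ¬ ParamEquiv s t) L → length L ≤ 2 * (length w * suc k !)
  nonequivalent-squares-bound = count-squares anchorCode anchorCode-injective
    λ x y codes≡ s≉t → s≉t ∘ same-half⇒ParamEquiv {x} {y} (anchorCode-injective x y codes≡)

  distinct-squares-bound : ∀ {L} → All (λ s → IsFactor s w × IsParamSquare s) L →
    Unique L → length L ≤ 2 * (length w * suc k ! * suc k !)
  distinct-squares-bound = count-squares anchorCode⁺ (λ x y → proj₁ ∘ anchorCode⁺-injective x y)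
    λ x y codes≡ s≢t → let x~y , ρ≗ = anchorCode⁺-injective x y codes≡ in
      s≢t ∘ same-half⇒≡ {x} {y} x~y ρ≗

2*[n*f]≡2*f*n : ∀ n f → 2 * (n * f) ≡ 2 * f * n
2*[n*f]≡2*f*n = solve-∀

2*[n*f*f]≡2*f^2*n : ∀ n f → 2 * (n * f * f) ≡ 2 * f ^ 2 * n
2*[n*f*f]≡2*f^2*n = unfolded
  where
  unfolded : ∀ n f → 2 * (n * f * f) ≡ 2 * (f * (f * 1)) * n
  unfolded = solve-∀

theorem28 : (n σ : ℕ) → NonZero n → NonZero σ → (w : Word σ) → length w ≡ n →
    ((L : List (Word σ)) → All (λ s → IsFactor s w × IsParamSquare s) L →
       AllPairs (λ s t → ¬ ParamEquiv s t) L → length L ≤ 2 * (σ !) * n)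
    × ((L : List (Word σ)) → All (λ s → IsFactor s w × IsParamSquare s) L →
       Unique L → length L ≤ 2 * ((σ !) ^ 2) * n)
theorem28 .(length w) (suc k) _ _ w refl =
  (λ L squares nonequivalent →
    subst (length L ≤_) (2*[n*f]≡2*f*n (length w) (suc k !))
      (nonequivalent-squares-bound w squares nonequivalent)) ,
  (λ L squares distinct →
    subst (length L ≤_) (2*[n*f*f]≡2*f^2*n (length w) (suc k !))
      (distinct-squares-bound w squares distinct))
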